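{- Let $\alpha\ge 0$ be an integer, let $p$ be a prime, $g$ an integer coprime to $p$, and $d_1,d_2$ positive integers. Suppose $p=2^{\alpha}d_1n^2+d_22^{\alpha}+1$ for some integer $n$. If $q$ is an odd prime with $\left(\frac{ -d_1d_2}{q}\right)\ne 1$ and $q\nmid d_2$, then $q\nmid r_p(g)$.
   Context: $r_p(g)=[(\mathbb Z/p\mathbb Z)^*:\langle g\rangle]$ is the residual index of $g \bmod p$. $\left(\frac{\cdot}{q}\right)$ is the Legendre symbol. -}

module Defs where

open import Data.Nat as ℕ using (ℕ; _<_; _∸_)
open import Data.Nat.Divisibility using (_∣?_)
open import Data.Integer as ℤ using (ℤ; +_; _-_; _*_; _^_; ∣_∣; 0ℤ; 1ℤ; -1ℤ)
open import Data.Integer.Divisibility using (_∣_)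
open import Data.Fin using (Fin; toℕ)
open import Data.Fin.Properties using (any?)
open import Data.Product using (Σ; _×_)
open import Relation.Nullary using (¬_; yes; no)
open import Relation.Binary.PropositionalEquality using (_≡_)

legendre : ℤ → ℕ → ℤ
legendre a q with q ∣? ∣ a ∣
... | yes _ = 0ℤ
... | no _ with any? {n = q} (λ (x : Fin q) → q ∣? ∣ (+ toℕ x) * (+ toℕ x) - a ∣)
...   | yes _ = 1ℤ
...   | no _  = -1ℤ

IsOrder : ℕ → ℤ → ℕ → Set
IsOrder p g k =
  (0 < k) × ((+ p) ∣ (g ^ k - 1ℤ))
    × (∀ j → 0 < j → j < k → ¬ ((+ p) ∣ (g ^ j - 1ℤ)))

-- Residual index r_p(g) = [(ℤ/pℤ)^* : ⟨g⟩] = (p - 1) / ord_p(g),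
-- i.e. r is the residual index iff r * ord_p(g) = p - 1.
IsResidualIndex : ℕ → ℤ → ℕ → Set
IsResidualIndex p g r = Σ ℕ (λ k → IsOrder p g k × (r ℕ.* k ≡ p ∸ 1))

{-# OPTIONS --safe #-}
-- Of the residual index only r ∣ p − 1 is used. Since p − 1 = 2^α (d₁n² + d₂)
-- and q is odd, q ∣ d₁n² + d₂; multiplying by d₁ gives (d₁n)² ≡ −d₁d₂ (mod q).
-- Moreover q ∤ d₁d₂, as q ∣ d₁ would force q ∣ d₂. So −d₁d₂ is a nonzero square
-- modulo q, i.e. its Legendre symbol is 1.
module Submission where

open import Defs
open import Data.Nat as ℕ using (ℕ; _∸_)
open import Data.Nat.Primality using (Prime; euclidsLemma; prime⇒nonZero; prime⇒nonTrivial)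
open import Data.Nat.Divisibility using (_∣_; _∣?_; ∣-trans; m∣m*n)
open import Data.Integer as ℤ using (ℤ; +_; -_; _+_; _*_; 1ℤ)
open import Data.Integer.Coprimality using (Coprime)
open import Data.Product using (∃; _,_)
open import Relation.Nullary using (¬_; yes; no; contradiction)
open import Relation.Binary.PropositionalEquality
  using (_≡_; _≢_; refl; sym; trans; cong; subst; module ≡-Reasoning)
open import Data.Sum using (inj₁; inj₂)
open import Data.Fin using (Fin; toℕ; fromℕ<)
open import Data.Fin.Properties using (any?; toℕ-fromℕ<)
open import Function using (_∘_)
import Data.Nat.Coprimality as ℕᶜ
import Data.Nat.Properties as ℕₚ
open import Data.Integer.Properties using (abs-*; ∣-i∣≡∣i∣)
open import Data.Integer.Divisibility.Signed as ℤᵈ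
  using (divides; ∣ᵤ⇒∣; ∣⇒∣ᵤ; ∣m∣n⇒∣m-n; ∣m⇒∣m*n; ∣n⇒∣m*n; ∣m+n∣m⇒∣n)
open import Data.Integer.DivMod using (_%ℕ_; _/ℕ_; n%ℕd<d; a≡a%ℕn+[a/ℕn]*n)
open import Data.Integer.Tactic.RingSolver using (solve-∀)

odd-prime⇒coprime-2 : ∀ {q} → Prime q → q ≢ 2 → ℕᶜ.Coprime q 2
odd-prime⇒coprime-2 {q} q-prime q≢2 = ℕᶜ.prime⇒coprime q-prime 2<q
  where
  2<q : 2 ℕ.< q
  2<q = ℕₚ.≤∧≢⇒< (ℕ.nonTrivial⇒n>1 q {{prime⇒nonTrivial q-prime}}) (q≢2 ∘ sym)

coprime-divisor-^ : ∀ {m n o} → ℕᶜ.Coprime m n → ∀ k → m ∣ n ℕ.^ k ℕ.* o → m ∣ o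
coprime-divisor-^ {m} {o = o} _ ℕ.zero m∣o = subst (m ∣_) (ℕₚ.*-identityˡ o) m∣o
coprime-divisor-^ {m} {n} {o} coprime (ℕ.suc k) m∣nᵏ⁺¹o =
  coprime-divisor-^ coprime k
    (ℕᶜ.coprime-divisor coprime (subst (m ∣_) (ℕₚ.*-assoc n (n ℕ.^ k) o) m∣nᵏ⁺¹o))

+n≡m+1⇒+[n∸1]≡m : ∀ {n m} → .{{ℕ.NonZero n}} → + n ≡ m + 1ℤ → + (n ∸ 1) ≡ m
+n≡m+1⇒+[n∸1]≡m {ℕ.suc n} {m} 1+n≡m+1 = begin
  + n                   ≡⟨ sub-1 (+ n) ⟨
  (1ℤ + + n) ℤ.- 1ℤ     ≡⟨ cong (ℤ._- 1ℤ) 1+n≡m+1 ⟩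
  (m + 1ℤ) ℤ.- 1ℤ       ≡⟨ trans (cong (ℤ._- 1ℤ) (+-comm m)) (sub-1 m) ⟩
  m                     ∎
  where
  open ≡-Reasoning
  sub-1 : ∀ i → (1ℤ + i) ℤ.- 1ℤ ≡ i
  sub-1 = solve-∀
  +-comm : ∀ i → i + 1ℤ ≡ 1ℤ + i
  +-comm = solve-∀

∣n-n%ℕd : ∀ n d .{{_ : ℕ.NonZero d}} → + d ℤᵈ.∣ n ℤ.- + (n %ℕ d)
∣n-n%ℕd n d = divides (n /ℕ d) (begin
  n ℤ.- + r                        ≡⟨ cong (ℤ._- + r) (a≡a%ℕn+[a/ℕn]*n n d) ⟩
  (+ r + n /ℕ d * + d) ℤ.- + r     ≡⟨ cancel (+ r) (n /ℕ d * + d) ⟩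
  n /ℕ d * + d                     ∎)
  where
  open ≡-Reasoning
  r = n %ℕ d
  cancel : ∀ i j → (i + j) ℤ.- i ≡ j
  cancel = solve-∀

∣x*x-a⇒∣y*y-a : ∀ {k} x y a → k ℤᵈ.∣ x ℤ.- y → k ℤᵈ.∣ x * x ℤ.- a → k ℤᵈ.∣ y * y ℤ.- a
∣x*x-a⇒∣y*y-a {k} x y a k∣x-y k∣x²-a =
  subst (k ℤᵈ.∣_) (sym (difference-of-squares x y a)) (∣m∣n⇒∣m-n k∣x²-a (∣m⇒∣m*n (x + y) k∣x-y))
  where
  difference-of-squares : ∀ x y a → y * y ℤ.- a ≡ (x * x ℤ.- a) ℤ.- (x ℤ.- y) * (x + y)
  difference-of-squares = solve-∀

legendre≡1 : ∀ a q .{{_ : ℕ.NonZero q}} x → ¬ (q ∣ ℤ.∣ a ∣) → + q ℤᵈ.∣ x * x ℤ.- a →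
             legendre a q ≡ 1ℤ
legendre≡1 a q x q∤a q∣x²-a with q ∣? ℤ.∣ a ∣
... | yes q∣a = contradiction q∣a q∤a
... | no _ with any? {n = q} (λ (y : Fin q) → q ∣? ℤ.∣ + toℕ y * + toℕ y ℤ.- a ∣)
...   | yes _   = refl
...   | no none = contradiction (fromℕ< x%q<q , q∣[x%q]²-a) none
  where
  x%q<q = n%ℕd<d x q
  q∣[x%q]²-a : q ∣ ℤ.∣ + toℕ (fromℕ< x%q<q) * + toℕ (fromℕ< x%q<q) ℤ.- a ∣
  q∣[x%q]²-a rewrite toℕ-fromℕ< x%q<q = ∣⇒∣ᵤ (∣x*x-a⇒∣y*y-a x (+ (x %ℕ q)) a (∣n-n%ℕd x q) q∣x²-a)

legendre[-d₁d₂]≡1 : ∀ {q} (d₁ d₂ n : ℤ) → Prime q → ¬ (+ q ℤᵈ.∣ d₂) →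
                    + q ℤᵈ.∣ d₁ * n * n + d₂ → legendre (- (d₁ * d₂)) q ≡ 1ℤ
legendre[-d₁d₂]≡1 {q} d₁ d₂ n q-prime q∤d₂ q∣d₁n²+d₂ =
  legendre≡1 (- (d₁ * d₂)) q (d₁ * n) q∤d₁d₂ q∣[d₁n]²+d₁d₂
  where
  instance _ = prime⇒nonZero q-prime
  d₁-times : ∀ d₁ d₂ n → d₁ * (d₁ * n * n + d₂) ≡ (d₁ * n) * (d₁ * n) ℤ.- - (d₁ * d₂)
  d₁-times = solve-∀
  q∣[d₁n]²+d₁d₂ : + q ℤᵈ.∣ (d₁ * n) * (d₁ * n) ℤ.- - (d₁ * d₂)
  q∣[d₁n]²+d₁d₂ = subst (+ q ℤᵈ.∣_) (d₁-times d₁ d₂ n) (∣n⇒∣m*n d₁ q∣d₁n²+d₂)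
  q∣d₁⇒q∣d₂ : + q ℤᵈ.∣ d₁ → + q ℤᵈ.∣ d₂
  q∣d₁⇒q∣d₂ q∣d₁ = ∣m+n∣m⇒∣n q∣d₁n²+d₂ (∣m⇒∣m*n n (∣m⇒∣m*n n q∣d₁))
  q∤d₁d₂ : ¬ (q ∣ ℤ.∣ - (d₁ * d₂) ∣)
  q∤d₁d₂ q∣d₁d₂ rewrite ∣-i∣≡∣i∣ (d₁ * d₂) | abs-* d₁ d₂
    with euclidsLemma ℤ.∣ d₁ ∣ ℤ.∣ d₂ ∣ q-prime q∣d₁d₂
  ... | inj₁ q∣d₁ = q∤d₂ (q∣d₁⇒q∣d₂ (∣ᵤ⇒∣ q∣d₁))
  ... | inj₂ q∣d₂ = q∤d₂ (∣ᵤ⇒∣ q∣d₂)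

lemma1 : (α p : ℕ) (g : ℤ) (d₁ d₂ : ℕ) → Prime p → Coprime g (+ p) →
           0 ℕ.< d₁ → 0 ℕ.< d₂ →
           ∃ (λ (n : ℤ) → + p ≡ + (2 ℕ.^ α) * + d₁ * n * n + + d₂ * + (2 ℕ.^ α) + 1ℤ) →
           (q : ℕ) → Prime q → q ≢ 2 →
           legendre (- (+ d₁ * + d₂)) q ≢ 1ℤ → ¬ (q ∣ d₂) →
           (r : ℕ) → IsResidualIndex p g r → ¬ (q ∣ r)
lemma1 α p g d₁ d₂ p-prime _ _ _ (n , p≡) q q-prime q≢2 legendre≢1 q∤d₂ r (k , _ , r*k≡p∸1) q∣r =
  legendre≢1 (legendre[-d₁d₂]≡1 (+ d₁) (+ d₂) n q-prime (q∤d₂ ∘ ∣⇒∣ᵤ) (∣ᵤ⇒∣ q∣M))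
  where
  instance _ = prime⇒nonZero p-prime
  2^α = + (2 ℕ.^ α)
  M = + d₁ * n * n + + d₂
  factor-2^α : ∀ a d₁ n d₂ → a * d₁ * n * n + d₂ * a ≡ a * (d₁ * n * n + d₂)
  factor-2^α = solve-∀
  p∸1≡2^αM : + (p ∸ 1) ≡ 2^α * M
  p∸1≡2^αM = trans (+n≡m+1⇒+[n∸1]≡m p≡) (factor-2^α 2^α (+ d₁) n (+ d₂))
  q∣2^α∣M∣ : q ∣ 2 ℕ.^ α ℕ.* ℤ.∣ M ∣
  q∣2^α∣M∣ = subst (q ∣_) r*k≡2^α∣M∣ (∣-trans q∣r (m∣m*n k))
    where
    r*k≡2^α∣M∣ : r ℕ.* k ≡ 2 ℕ.^ α ℕ.* ℤ.∣ M ∣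
    r*k≡2^α∣M∣ = trans r*k≡p∸1 (trans (cong ℤ.∣_∣ p∸1≡2^αM) (abs-* 2^α M))
  q∣M : q ∣ ℤ.∣ M ∣
  q∣M = coprime-divisor-^ (odd-prime⇒coprime-2 q-prime q≢2) α q∣2^α∣M∣
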